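{- For all positive integers $k$ and $n$, \[\operatorname{sat}(Q_n, P_k) \le \lfloor \log_2 k \rfloor \cdot 2^{n-1}.\]
   Context: $Q_n$ is the $n$-dimensional hypercube: vertex set $\{0,1\}^n$, two vertices adjacent iff they differ in exactly one coordinate. $P_k$ denotes the path with $k$ edges (i.e. $k+1$ vertices). For a graph $G$, a subgraph $H'$ of $Q_n$ is $(Q_n,G)$-saturated if it contains no subgraph isomorphic to $G$ but adding any edge of $Q_n$ not in $H'$ creates a subgraph isomorphic to $G$; $\operatorname{sat}(Q_n,G)$ is the minimum number of edges of such a subgraph. -}

module Defs where

open import Data.Nat using (ℕ; zero; suc; _+_; _≤_; _*_; _^_; _∸_)
open import Data.Bool using (Bool; true; false; not; _∧_; if_then_else_)
open import Data.Vec using (Vec; []; _∷_; lookup; _[_]≔_; _[_]%=_)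
open import Data.Vec.Properties using (≡-dec)
open import Data.Fin using (Fin; inject₁) renaming (suc to fsuc)
import Data.Fin.Properties as FinP
open import Data.Bool.Properties using () renaming (_≟_ to _≟B_)
open import Data.List using (List; [_]; _++_; map; allFin)
open import Data.Nat.ListAction using (sum)
open import Data.Product using (Σ; ∃-syntax; _×_)
open import Relation.Binary.PropositionalEquality using (_≡_)
open import Relation.Nullary using (¬_; Dec; yes; no)
open import Function.Definitions using (Injective)

Vertex : ℕ → Set
Vertex n = Vec Bool n

flip : ∀ {n} → Vertex n → Fin n → Vertex n
flip u i = u [ i ]%= not

-- Canonical representative of the edge {u, flip u i}: its endpoint with i-th bit 0.
lower : ∀ {n} → Vertex n → Fin n → Vertex n
lower u i = u [ i ]≔ false

-- A subgraph of Q_n, given by its edge set: the edge {v, flip v i} with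
-- lookup v i ≡ false is present iff  H v i ≡ true.
-- (Values H v i with lookup v i ≡ true are irrelevant / ignored.)
Subgraph : ℕ → Set
Subgraph n = Vertex n → Fin n → Bool

HasEdge : ∀ {n} → Subgraph n → Vertex n → Fin n → Set
HasEdge H u i = H (lower u i) i ≡ true

Adj : ∀ {n} → Subgraph n → Vertex n → Vertex n → Set
Adj H u w = ∃[ i ] (w ≡ flip u i × HasEdge H u i)

-- H contains a subgraph isomorphic to P_k (path with k edges, k+1 distinct vertices).
ContainsPath : ∀ {n} → Subgraph n → ℕ → Set
ContainsPath {n} H k =
  ∃[ p ] (Injective _≡_ _≡_ p × ((j : Fin k) → Adj H (p (inject₁ j)) (p (fsuc j))))

-- H with the edge {v, flip v i} (v canonical, i.e. lookup v i ≡ false) added.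
addEdge : ∀ {n} → Subgraph n → Vertex n → Fin n → Subgraph n
addEdge H v i w j with ≡-dec _≟B_ w v | FinP._≟_ j i
... | yes _ | yes _ = true
... | _     | _     = H w j

Saturated : (n k : ℕ) → Subgraph n → Set
Saturated n k H =
  ¬ ContainsPath H k ×
  ((v : Vertex n) (i : Fin n) → lookup v i ≡ false → H v i ≡ false →
     ContainsPath (addEdge H v i) k)

allVertices : (n : ℕ) → List (Vertex n)
allVertices zero = [ [] ]
allVertices (suc n) = map (false ∷_) (allVertices n) ++ map (true ∷_) (allVertices n)

-- Number of edges of H (each edge counted once, via its canonical endpoint).
edgeCount : ∀ {n} → Subgraph n → ℕ
edgeCount {n} H =
  sum (map (λ v → sum (map (λ i → if not (lookup v i) ∧ H v i then 1 else 0) (allFin n)))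
           (allVertices n))

module Submission where

-- Put m = ⌊log₂ k⌋, so that 2^m ≤ k < 2^(m+1).  The witness H_m consists of
-- all edges of Q_n in the first m coordinate directions, so it is the
-- disjoint union of the subcubes spanned by those directions.
--   * H_m has no P_k: a path in H_m never leaves the subcube of its first
--     vertex, which has 2^min(m,n) ≤ k vertices, fewer than the k+1 needed.
--   * Saturation: a missing edge v v' has a direction i ≥ m (so m ≤ n) and
--     joins two disjoint copies of Q_m.  A Hamiltonian path of the first copy
--     ending at v, the new edge, and a Hamiltonian path of the second copy
--     starting at v' form a path on 2^(m+1) ≥ k+1 vertices.
--   * Size: each direction of H_m carries 2^(n-1) edges, so H_m has
--     min(m,n) · 2^(n-1) edges.

open import Defs
open import Data.Nat
  using (ℕ; zero; suc; _+_; _*_; _^_; _∸_; _⊓_; _≤_; _<_; _<ᵇ_; z≤n; s≤s; ⌊_/2⌋)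
open import Data.Nat.Properties
  using ( ≤-trans; ≤-reflexive; +-identityʳ; +-monoʳ-≤; *-monoʳ-≤; *-monoˡ-≤; *-cancelˡ-≤
        ; ⌊n/2⌋+⌈n/2⌉≡n; ⌊n/2⌋≤⌈n/2⌉; 1+n≰n; ≰⇒>; <-irrefl; ^-monoʳ-≤
        ; m⊓n≤m; m≤n⇒m⊓n≡m; module ≤-Reasoning)
open import Data.Nat.Logarithm using (⌊log₂_⌋; ⌊log₂⌋-mono-≤; ⌊log₂⌊n/2⌋⌋≡⌊log₂n⌋∸1; ⌊log₂[2^n]⌋≡n)
open import Data.Nat.ListAction using (sum)
open import Data.Nat.ListAction.Properties using (sum-++)
open import Data.Nat.Tactic.RingSolver using (solve-∀)
open import Data.Bool using (Bool; true; false; not; _∧_; if_then_else_)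
open import Data.Bool.Properties using (not-involutive; not-¬; ¬-not) renaming (_≟_ to _≟B_)
open import Data.Fin using (Fin; toℕ; inject₁; inject≤) renaming (zero to fzero; suc to fsuc)
import Data.Fin.Properties as Fin
open import Data.Vec using ([]; _∷_; lookup; _[_]≔_)
open import Data.Vec.Properties
  using ( ≡-dec; lookup∘updateAt; lookup∘updateAt′; updateAt-updateAt; updateAt-id-local
        ; []≔-lookup; tabulate∘lookup; tabulate-cong)
open import Data.List using (List; []; _∷_; _++_; length; reverse; map; tabulate)
import Data.List as List
open import Data.List.Properties using (length-++; length-reverse; length-map; map-++; map-∘; map-cong; unfold-reverse)
open import Data.List.Membership.Propositional using (_∈_; _∉_)
open import Data.List.Membership.Propositional.Properties using (∈-map⁺; ∈-map⁻; ∈-lookup; ∈-++⁺ˡ; ∈-++⁺ʳ; ∈-++⁻)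
open import Data.List.Relation.Unary.Any using (here; there; index)
open import Data.List.Relation.Unary.Any.Properties using (lookup-index; reverse⁻)
open import Data.List.Relation.Unary.All using ([])
open import Data.List.Relation.Unary.All.Properties using (¬Any⇒All¬)
open import Data.List.Relation.Unary.Unique.Propositional using (Unique; []; _∷_)
import Data.List.Relation.Unary.Unique.Propositional.Properties as Unique
import Data.List.Relation.Binary.Permutation.Setoid as Permutation
import Data.List.Relation.Binary.Permutation.Setoid.Properties as PermutationProperties
open import Data.Product using (∃-syntax; _×_; _,_)
open import Data.Sum using (inj₁; inj₂)
open import Data.Empty using (⊥)
open import Function using (_∘_; _⇔_; mk⇔; Equivalence)
open import Function.Definitions using (Injective)
open import Relation.Nullary using (¬_; yes; no; contradiction)
open import Relation.Binary.PropositionalEquality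

open Equivalence using (to; from)

half+half≤ : ∀ n → ⌊ n /2⌋ + ⌊ n /2⌋ ≤ n
half+half≤ n =
  subst (⌊ n /2⌋ + ⌊ n /2⌋ ≤_) (⌊n/2⌋+⌈n/2⌉≡n n) (+-monoʳ-≤ ⌊ n /2⌋ (⌊n/2⌋≤⌈n/2⌉ n))

-- 2^⌊log₂ k⌋ ≤ k for k ≥ 1; induction on the value m of the logarithm,
-- using ⌊log₂ ⌊k/2⌋⌋ = ⌊log₂ k⌋ - 1.
2^⌊log₂⌋≤ : ∀ k → 1 ≤ k → 2 ^ ⌊log₂ k ⌋ ≤ k
2^⌊log₂⌋≤ k = bound ⌊log₂ k ⌋ k refl
  where
  bound : ∀ m k → ⌊log₂ k ⌋ ≡ m → 1 ≤ k → 2 ^ m ≤ k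
  bound zero    k                 _    1≤k = 1≤k
  bound (suc m) (suc zero)        log≡ _   = contradiction (trans (sym (⌊log₂[2^n]⌋≡n 0)) log≡) λ ()
  bound (suc m) k@(suc (suc _))   log≡ _   = begin
      2 * 2 ^ m  ≤⟨ *-monoʳ-≤ 2 (bound m h log-half (s≤s z≤n)) ⟩
      2 * h      ≡⟨ cong (h +_) (+-identityʳ h) ⟩
      h + h      ≤⟨ half+half≤ k ⟩
      k          ∎
    where
    open ≤-Reasoning
    h = ⌊ k /2⌋
    log-half : ⌊log₂ h ⌋ ≡ m
    log-half = trans (⌊log₂⌊n/2⌋⌋≡⌊log₂n⌋∸1 k) (cong (_∸ 1) log≡)

-- k < 2^(⌊log₂ k⌋+1): otherwise monotonicity of ⌊log₂⌋ would give
-- ⌊log₂ k⌋ + 1 ≤ ⌊log₂ k⌋.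
<2^suc⌊log₂⌋ : ∀ k → k < 2 ^ suc ⌊log₂ k ⌋
<2^suc⌊log₂⌋ k = ≰⇒> λ big →
  1+n≰n (subst (_≤ ⌊log₂ k ⌋) (⌊log₂[2^n]⌋≡n (suc ⌊log₂ k ⌋)) (⌊log₂⌋-mono-≤ big))

vertex-ext : ∀ {n} {x y : Vertex n} → (∀ j → lookup x j ≡ lookup y j) → x ≡ y
vertex-ext {x = x} {y} same =
  trans (sym (tabulate∘lookup x)) (trans (tabulate-cong same) (tabulate∘lookup y))

flip-same : ∀ {n} (u : Vertex n) i → lookup (flip u i) i ≡ not (lookup u i)
flip-same u i = lookup∘updateAt i u

flip-other : ∀ {n} (u : Vertex n) {i j} → j ≢ i → lookup (flip u i) j ≡ lookup u j
flip-other u {i} {j} j≢i = lookup∘updateAt′ j i j≢i u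

flip-involutive : ∀ {n} (u : Vertex n) i → flip (flip u i) i ≡ u
flip-involutive u i =
  trans (updateAt-updateAt i u) (updateAt-id-local i u (not-involutive (lookup u i)))

lower-canonical : ∀ {n} (v : Vertex n) i → lookup v i ≡ false → lower v i ≡ v
lower-canonical v i vi≡false = trans (cong (v [ i ]≔_) (sym vi≡false)) ([]≔-lookup v i)

data Chain {A : Set} (R : A → A → Set) : A → A → List A → Set where
  stop : ∀ {x} → Chain R x x (x ∷ [])
  step : ∀ {x y z ys} → R x y → Chain R y z ys → Chain R x z (x ∷ ys)

module _ {A : Set} {R : A → A → Set} where

  chain-++ : ∀ {x y y′ z xs ys} → Chain R x y xs → R y y′ → Chain R y′ z ys → Chain R x z (xs ++ ys)
  chain-++ stop         r c = step r c
  chain-++ (step r′ c′) r c = step r′ (chain-++ c′ r c)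

  chain-reverse : (∀ {a b} → R a b → R b a) → ∀ {x y xs} → Chain R x y xs → Chain R y x (reverse xs)
  chain-reverse sym-R stop = stop
  chain-reverse sym-R (step {x} {_} {z} {ys} r c) =
    subst (Chain R z x) (sym (unfold-reverse x ys)) (chain-++ (chain-reverse sym-R c) (sym-R r) stop)

  chain-end∈ : ∀ {x y xs} → Chain R x y xs → y ∈ xs
  chain-end∈ stop       = here refl
  chain-end∈ (step _ c) = there (chain-end∈ c)

  chain-map : ∀ {S : A → A → Set} → (∀ {a b} → R a b → S a b) → ∀ {x y xs} → Chain R x y xs → Chain S x y xs
  chain-map f stop       = stop
  chain-map f (step r c) = step (f r) (chain-map f c)

  chain-consecutive : ∀ {x y xs} → Chain R x y xs → ∀ {k} (a : Fin k) (k<len : suc k ≤ length xs) →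
    R (List.lookup xs (inject≤ (inject₁ a) k<len)) (List.lookup xs (inject≤ (fsuc a) k<len))
  chain-consecutive stop                {suc _} _        (s≤s ())
  chain-consecutive (step r stop)       fzero    (s≤s _)  = r
  chain-consecutive (step r (step _ _)) fzero    (s≤s _)  = r
  chain-consecutive (step _ c)          (fsuc a) (s≤s k<len) = chain-consecutive c a k<len

unique-reverse : ∀ {A : Set} (xs : List A) → Unique xs → Unique (reverse xs)
unique-reverse {A} xs = Unique-resp-↭ (Permutation.↭-sym (setoid A) (↭-reverse xs))
  where open PermutationProperties (setoid A)

lookup-injective : ∀ {A : Set} (xs : List A) → Unique xs → Injective _≡_ _≡_ (List.lookup xs)
lookup-injective (x ∷ xs) u {fzero}  {fzero}  eq = refl
lookup-injective (x ∷ xs) u {fzero}  {fsuc j} eq =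
  contradiction (subst (_∈ xs) (sym eq) (∈-lookup j)) (Unique.Unique[x∷xs]⇒x∉xs u)
lookup-injective (x ∷ xs) u {fsuc i} {fzero}  eq =
  contradiction (subst (_∈ xs) eq (∈-lookup i)) (Unique.Unique[x∷xs]⇒x∉xs u)
lookup-injective (x ∷ xs) (_ ∷ u) {fsuc i} {fsuc j} eq = cong fsuc (lookup-injective xs u eq)

chain⇒path : ∀ {n} {H : Subgraph n} {x y xs} k →
  Chain (Adj H) x y xs → Unique xs → suc k ≤ length xs → ContainsPath H k
chain⇒path {xs = xs} k c u k<len =
  (λ j → List.lookup xs (inject≤ j k<len)) , injective , λ j → chain-consecutive c j k<len
  where
  injective : ∀ {a b} → List.lookup xs (inject≤ a k<len) ≡ List.lookup xs (inject≤ b k<len) → a ≡ b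
  injective {a} {b} eq = Fin.toℕ-injective (begin
    toℕ a                 ≡⟨ Fin.toℕ-inject≤ a k<len ⟨
    toℕ (inject≤ a k<len) ≡⟨ cong toℕ (lookup-injective xs u eq) ⟩
    toℕ (inject≤ b k<len) ≡⟨ Fin.toℕ-inject≤ b k<len ⟩
    toℕ b                 ∎)
    where open ≡-Reasoning

path-invariant : ∀ {A : Set} (R : A → A → Set) (P : A → Set) → (∀ {x y} → P x → R x y → P y) →
  ∀ k (p : Fin (suc k) → A) → (∀ j → R (p (inject₁ j)) (p (fsuc j))) → P (p fzero) → ∀ j → P (p j)
path-invariant R P preserved k       p adj p₀ fzero    = p₀
path-invariant R P preserved (suc k) p adj p₀ (fsuc j) =
  preserved (path-invariant R P preserved k (p ∘ inject₁) (adj ∘ inject₁) p₀ j) (adj j)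

injective-into-short-list : ∀ {A : Set} {k} (xs : List A) → length xs ≤ k →
  (p : Fin (suc k) → A) → Injective _≡_ _≡_ p → (∀ j → p j ∈ xs) → ⊥
injective-into-short-list xs len≤k p p-injective p∈xs
  with Fin.pigeonhole (s≤s len≤k) (λ j → index (p∈xs j))
... | i , j , i<j , same-index = <-irrefl (cong toℕ (p-injective pᵢ≡pⱼ)) i<j
  where
  pᵢ≡pⱼ : p i ≡ p j
  pᵢ≡pⱼ = trans (lookup-index (p∈xs i))
            (trans (cong (List.lookup xs) same-index) (sym (lookup-index (p∈xs j))))

Step : ∀ {n} → (Fin n → Set) → Vertex n → Vertex n → Set
Step P x y = ∃[ d ] (P d × y ≡ flip x d)

step-sym : ∀ {n} {P : Fin n → Set} {x y} → Step P x y → Step P y x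
step-sym {x = x} (d , Pd , refl) = d , Pd , sym (flip-involutive x d)

InSubcube : ∀ {n} → List (Fin n) → Vertex n → Vertex n → Set
InSubcube ds b x = ∀ j → j ∉ ds → lookup x j ≡ lookup b j

-- A Hamiltonian walk of the subcube through b spanned by ds, and its last vertex:
-- walk the subcube of ds, cross direction d, walk the parallel subcube.
cubeWalkEnd : ∀ {n} → Vertex n → List (Fin n) → Vertex n
cubeWalkEnd b []       = b
cubeWalkEnd b (d ∷ ds) = cubeWalkEnd (flip (cubeWalkEnd b ds) d) ds

cubeWalk : ∀ {n} → Vertex n → List (Fin n) → List (Vertex n)
cubeWalk b []       = b ∷ []
cubeWalk b (d ∷ ds) = cubeWalk b ds ++ cubeWalk (flip (cubeWalkEnd b ds) d) ds

cubeWalk-chain : ∀ {n} (b : Vertex n) ds → Chain (Step (_∈ ds)) b (cubeWalkEnd b ds) (cubeWalk b ds)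
cubeWalk-chain b []       = stop
cubeWalk-chain b (d ∷ ds) =
  chain-++ (chain-map widen (cubeWalk-chain b ds)) (d , here refl , refl) (chain-map widen (cubeWalk-chain _ ds))
  where
  widen : ∀ {x y} → Step (_∈ ds) x y → Step (_∈ d ∷ ds) x y
  widen (d′ , d′∈ds , eq) = d′ , there d′∈ds , eq

cubeWalk-length : ∀ {n} (b : Vertex n) ds → length (cubeWalk b ds) ≡ 2 ^ length ds
cubeWalk-length b []       = refl
cubeWalk-length b (d ∷ ds) = begin
  length (cubeWalk b ds ++ cubeWalk b′ ds)         ≡⟨ length-++ (cubeWalk b ds) ⟩
  length (cubeWalk b ds) + length (cubeWalk b′ ds) ≡⟨ cong₂ _+_ (cubeWalk-length b ds) (cubeWalk-length b′ ds) ⟩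
  2 ^ length ds + 2 ^ length ds                    ≡⟨ cong (2 ^ length ds +_) (+-identityʳ _) ⟨
  2 ^ length (d ∷ ds)                              ∎
  where
  open ≡-Reasoning
  b′ = flip (cubeWalkEnd b ds) d

cubeWalkEnd-inside : ∀ {n} (b : Vertex n) ds → InSubcube ds b (cubeWalkEnd b ds)

cubeWalk-inside : ∀ {n} (b : Vertex n) ds x → x ∈ cubeWalk b ds → InSubcube ds b x
cubeWalk-inside b [] x (here refl) j _ = refl
cubeWalk-inside b (d ∷ ds) x x∈walk j j∉d∷ds with ∈-++⁻ (cubeWalk b ds) x∈walk
... | inj₁ x∈first  = cubeWalk-inside b ds x x∈first j j∉ds
  where j∉ds = j∉d∷ds ∘ there
... | inj₂ x∈second = begin
  lookup x j                                  ≡⟨ cubeWalk-inside _ ds x x∈second j j∉ds ⟩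
  lookup (flip (cubeWalkEnd b ds) d) j        ≡⟨ flip-other (cubeWalkEnd b ds) (j∉d∷ds ∘ here) ⟩
  lookup (cubeWalkEnd b ds) j                 ≡⟨ cubeWalkEnd-inside b ds j j∉ds ⟩
  lookup b j                                  ∎
  where
  open ≡-Reasoning
  j∉ds = j∉d∷ds ∘ there

cubeWalkEnd-inside b ds = cubeWalk-inside b ds _ (chain-end∈ (cubeWalk-chain b ds))

parallel-walks-disjoint : ∀ {n} (b c : Vertex n) ds {d} → d ∉ ds → lookup c d ≡ not (lookup b d) →
  ∀ {x} → ¬ (x ∈ cubeWalk b ds × x ∈ cubeWalk c ds)
parallel-walks-disjoint b c ds {d} d∉ds c-differs {x} (x∈first , x∈second) = not-¬ refl (begin
  lookup b d        ≡⟨ cubeWalk-inside b ds x x∈first d d∉ds ⟨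
  lookup x d        ≡⟨ cubeWalk-inside c ds x x∈second d d∉ds ⟩
  lookup c d        ≡⟨ c-differs ⟩
  not (lookup b d)  ∎)
  where open ≡-Reasoning

-- The two halves of the walk lie in parallel subcubes, so no vertex is repeated.
cubeWalk-unique : ∀ {n} (b : Vertex n) ds → Unique ds → Unique (cubeWalk b ds)
cubeWalk-unique b []       _                  = [] ∷ []
cubeWalk-unique b (d ∷ ds) u@(_ ∷ ds-unique) =
  Unique.++⁺ (cubeWalk-unique b ds ds-unique) (cubeWalk-unique _ ds ds-unique)
    (parallel-walks-disjoint b _ ds d∉ds
      (trans (flip-same e d) (cong not (cubeWalkEnd-inside b ds d d∉ds))))
  where
  d∉ds = Unique.Unique[x∷xs]⇒x∉xs u
  e = cubeWalkEnd b ds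

cubeWalk-complete : ∀ {n} (b : Vertex n) ds → Unique ds → ∀ x → InSubcube ds b x → x ∈ cubeWalk b ds
cubeWalk-complete b [] _ x x-inside = here (vertex-ext λ j → x-inside j λ ())
cubeWalk-complete b (d ∷ ds) u@(_ ∷ ds-unique) x x-inside with lookup x d ≟B lookup b d
... | yes same = ∈-++⁺ˡ (cubeWalk-complete b ds ds-unique x x-inside-first)
  where
  x-inside-first : InSubcube ds b x
  x-inside-first j j∉ds with j Fin.≟ d
  ... | yes refl = same
  ... | no  j≢d  = x-inside j λ { (here j≡d) → j≢d j≡d ; (there j∈ds) → j∉ds j∈ds }
... | no differ = ∈-++⁺ʳ (cubeWalk b ds) (cubeWalk-complete _ ds ds-unique x x-inside-second)
  where
  d∉ds = Unique.Unique[x∷xs]⇒x∉xs u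
  e = cubeWalkEnd b ds
  x-inside-second : InSubcube ds (flip e d) x
  x-inside-second j j∉ds with j Fin.≟ d
  ... | yes refl = trans (¬-not differ)
                     (sym (trans (flip-same e d) (cong not (cubeWalkEnd-inside b ds d d∉ds))))
  ... | no  j≢d  = trans (x-inside j λ { (here j≡d) → j≢d j≡d ; (there j∈ds) → j∉ds j∈ds })
                     (sym (trans (flip-other e j≢d) (cubeWalkEnd-inside b ds j j∉ds)))

directionSubgraph : ∀ {n} → (Fin n → Bool) → Subgraph n
directionSubgraph D v j = D j

Enumerates : ∀ {n} → List (Fin n) → (Fin n → Bool) → Set
Enumerates ds D = ∀ d → D d ≡ true ⇔ d ∈ ds

edge-inside-subcube : ∀ {n} {D} {ds} {b x y : Vertex n} → Enumerates ds D →
  InSubcube ds b x → Adj (directionSubgraph D) x y → InSubcube ds b y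
edge-inside-subcube {ds = ds} {x = x} enum x-inside (i , refl , Di) j j∉ds =
  trans (flip-other x λ j≡i → j∉ds (subst (_∈ ds) (sym j≡i) (to (enum i) Di))) (x-inside j j∉ds)

-- If 2^|ds| ≤ k then H_D has no P_k: all vertices of a path lie in the
-- subcube of its first vertex, which has only 2^|ds| vertices.
no-long-path : ∀ {n} {D} {ds : List (Fin n)} {k} → Unique ds → Enumerates ds D → 2 ^ length ds ≤ k →
  ¬ ContainsPath (directionSubgraph D) k
no-long-path {D = D} {ds} {k} ds-unique enum small (p , p-injective , p-adj) =
  injective-into-short-list walk (≤-trans (≤-reflexive (cubeWalk-length (p fzero) ds)) small)
    p p-injective p∈walk
  where
  walk = cubeWalk (p fzero) ds
  p∈walk : ∀ j → p j ∈ walk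
  p∈walk j = cubeWalk-complete (p fzero) ds ds-unique (p j)
    (path-invariant (Adj (directionSubgraph D)) (InSubcube ds (p fzero)) (edge-inside-subcube {b = p fzero} enum)
       k p p-adj (λ _ _ → refl) j)

addEdge-keeps : ∀ {n} (H : Subgraph n) v i w j → H w j ≡ true → addEdge H v i w j ≡ true
addEdge-keeps H v i w j Hwj with ≡-dec _≟B_ w v | Fin._≟_ j i
... | yes _ | yes _ = refl
... | yes _ | no  _ = Hwj
... | no  _ | _     = Hwj

addEdge-new : ∀ {n} (H : Subgraph n) v i → addEdge H v i v i ≡ true
addEdge-new H v i with ≡-dec _≟B_ v v | Fin._≟_ i i
... | yes _ | yes _  = refl
... | yes _ | no i≢i = contradiction refl i≢i
... | no v≢v | _     = contradiction refl v≢v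

-- If k < 2^(|ds|+1) then adding a missing edge {v, v′} to H_D creates a P_k:
-- traverse the subcube of v backwards to v, cross the new edge, and traverse
-- the (disjoint) subcube of v′; together these have 2^(|ds|+1) vertices.
adding-edge-creates-path : ∀ {n} {D} {ds : List (Fin n)} {k} → Unique ds → Enumerates ds D →
  k < 2 ^ suc (length ds) → (v : Vertex n) (i : Fin n) → lookup v i ≡ false → D i ≡ false →
  ContainsPath (addEdge (directionSubgraph D) v i) k
adding-edge-creates-path {D = D} {ds} {k} ds-unique enum large v i vi≡false Di≡false =
  chain⇒path {H = H′} k walk unique long
  where
  H′ = addEdge (directionSubgraph D) v i
  v′ = flip v i
  i∉ds : i ∉ ds
  i∉ds i∈ds = contradiction (trans (sym Di≡false) (from (enum i) i∈ds)) λ ()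
  old-edge : ∀ {x y} → Step (_∈ ds) x y → Adj H′ x y
  old-edge {x} (d , d∈ds , y≡) =
    d , y≡ , addEdge-keeps (directionSubgraph D) v i (lower x d) d (from (enum d) d∈ds)
  new-edge : Adj H′ v v′
  new-edge = i , refl ,
    subst (λ w → H′ w i ≡ true) (sym (lower-canonical v i vi≡false)) (addEdge-new (directionSubgraph D) v i)
  first  = reverse (cubeWalk v ds)
  second = cubeWalk v′ ds
  walk : Chain (Adj H′) (cubeWalkEnd v ds) (cubeWalkEnd v′ ds) (first ++ second)
  walk = chain-++ (chain-map old-edge (chain-reverse step-sym (cubeWalk-chain v ds))) new-edge
                  (chain-map old-edge (cubeWalk-chain v′ ds))
  unique : Unique (first ++ second)
  unique = Unique.++⁺ (unique-reverse _ (cubeWalk-unique v ds ds-unique)) (cubeWalk-unique v′ ds ds-unique)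
    λ (x∈first , x∈second) → parallel-walks-disjoint v v′ ds i∉ds (flip-same v i) (reverse⁻ x∈first , x∈second)
  long : suc k ≤ length (first ++ second)
  long = begin
    suc k                                 ≤⟨ large ⟩
    2 ^ length ds + (2 ^ length ds + 0)   ≡⟨ cong (2 ^ length ds +_) (+-identityʳ _) ⟩
    2 ^ length ds + 2 ^ length ds         ≡⟨ cong₂ _+_ (trans (length-reverse (cubeWalk v ds)) (cubeWalk-length v ds))
                                                        (cubeWalk-length v′ ds) ⟨
    length first + length second          ≡⟨ length-++ first ⟨
    length (first ++ second)              ∎
    where open ≤-Reasoning

ΣFin : (n : ℕ) → (Fin n → ℕ) → ℕ
ΣFin zero    f = 0
ΣFin (suc n) f = f fzero + ΣFin n (f ∘ fsuc)

sum-map-tabulate : ∀ {A : Set} n (g : Fin n → A) (f : A → ℕ) → sum (map f (tabulate g)) ≡ ΣFin n (f ∘ g)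
sum-map-tabulate zero    g f = refl
sum-map-tabulate (suc n) g f = cong (f (g fzero) +_) (sum-map-tabulate n (g ∘ fsuc) f)

ΣV : (n : ℕ) → (Vertex n → ℕ) → ℕ
ΣV n F = sum (map F (allVertices n))

ΣV-suc : ∀ n F → ΣV (suc n) F ≡ ΣV n (F ∘ (false ∷_)) + ΣV n (F ∘ (true ∷_))
ΣV-suc n F = begin
  sum (map F (map (false ∷_) vs ++ map (true ∷_) vs))          ≡⟨ cong sum (map-++ F (map (false ∷_) vs) _) ⟩
  sum (map F (map (false ∷_) vs) ++ map F (map (true ∷_) vs))  ≡⟨ sum-++ (map F (map (false ∷_) vs)) _ ⟩
  sum (map F (map (false ∷_) vs)) + sum (map F (map (true ∷_) vs))
    ≡⟨ cong₂ _+_ (cong sum (map-∘ vs)) (cong sum (map-∘ vs)) ⟨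
  ΣV n (F ∘ (false ∷_)) + ΣV n (F ∘ (true ∷_))                 ∎
  where
  open ≡-Reasoning
  vs = allVertices n

ΣV-shift : ∀ n c F → ΣV n (λ w → c + F w) ≡ c * 2 ^ n + ΣV n F
ΣV-shift zero    c F = base c (F [])
  where
  base : ∀ c x → c + x + 0 ≡ c * 1 + (x + 0)
  base = solve-∀
ΣV-shift (suc n) c F = begin
  ΣV (suc n) (λ w → c + F w)                                         ≡⟨ ΣV-suc n _ ⟩
  ΣV n (λ w → c + F (false ∷ w)) + ΣV n (λ w → c + F (true ∷ w))     ≡⟨ cong₂ _+_ (ΣV-shift n c _) (ΣV-shift n c _) ⟩
  (c * 2 ^ n + ΣV n (F ∘ (false ∷_))) + (c * 2 ^ n + ΣV n (F ∘ (true ∷_)))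
    ≡⟨ regroup c (2 ^ n) _ _ ⟩
  c * (2 * 2 ^ n) + (ΣV n (F ∘ (false ∷_)) + ΣV n (F ∘ (true ∷_)))  ≡⟨ cong (c * 2 ^ suc n +_) (ΣV-suc n F) ⟨
  c * 2 ^ suc n + ΣV (suc n) F                                       ∎
  where
  open ≡-Reasoning
  regroup : ∀ c P a b → (c * P + a) + (c * P + b) ≡ c * (2 * P) + (a + b)
  regroup = solve-∀

indicator : Bool → ℕ
indicator b = if b then 1 else 0

count : ∀ n → (Fin n → Bool) → ℕ
count n D = ΣFin n (indicator ∘ D)

upDegree : ∀ n → (Fin n → Bool) → Vertex n → ℕ
upDegree n D v = ΣFin n (λ i → indicator (not (lookup v i) ∧ D i))

edgeCount-directionSubgraph : ∀ n D → edgeCount {n} (directionSubgraph D) ≡ ΣV n (upDegree n D)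
edgeCount-directionSubgraph n D =
  cong sum (map-cong (λ v → sum-map-tabulate n (λ i → i) _) (allVertices n))

-- Each direction of D carries 2^(n-1) edges of Q_n:  2 · |E(H_D)| = |D| · 2^n.
-- In Q_{n+1} the first direction contributes one edge per vertex of the bottom copy of Q_n,
-- and the other directions contribute their edges in both copies.
double-edgeCount : ∀ n D → 2 * ΣV n (upDegree n D) ≡ count n D * 2 ^ n
double-edgeCount zero    D = refl
double-edgeCount (suc n) D = begin
  2 * ΣV (suc n) (upDegree (suc n) D)                ≡⟨ cong (2 *_) (ΣV-suc n _) ⟩
  2 * (ΣV n (λ w → b + upDegree n D′ w) + E)         ≡⟨ cong (λ t → 2 * (t + E)) (ΣV-shift n b _) ⟩
  2 * (b * 2 ^ n + E + E)                            ≡⟨ regroup b (2 ^ n) E ⟩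
  b * (2 * 2 ^ n) + 2 * (2 * E)                      ≡⟨ cong (λ t → b * (2 * 2 ^ n) + 2 * t) (double-edgeCount n D′) ⟩
  b * (2 * 2 ^ n) + 2 * (count n D′ * 2 ^ n)         ≡⟨ factor b (count n D′) (2 ^ n) ⟩
  (b + count n D′) * (2 * 2 ^ n)                     ∎
  where
  open ≡-Reasoning
  D′ = D ∘ fsuc
  b  = indicator (D fzero)
  E  = ΣV n (upDegree n D′)
  regroup : ∀ b P E → 2 * (b * P + E + E) ≡ b * (2 * P) + 2 * (2 * E)
  regroup = solve-∀
  factor : ∀ b C P → b * (2 * P) + 2 * (C * P) ≡ (b + C) * (2 * P)
  factor = solve-∀

below : ∀ {n} → ℕ → Fin n → Bool
below m j = toℕ j <ᵇ m

firstDirections : (n m : ℕ) → List (Fin n)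
firstDirections zero    m       = []
firstDirections (suc n) zero    = []
firstDirections (suc n) (suc m) = fzero ∷ map fsuc (firstDirections n m)

firstDirections-length : ∀ n m → length (firstDirections n m) ≡ m ⊓ n
firstDirections-length zero    zero    = refl
firstDirections-length zero    (suc m) = refl
firstDirections-length (suc n) zero    = refl
firstDirections-length (suc n) (suc m) =
  cong suc (trans (length-map fsuc (firstDirections n m)) (firstDirections-length n m))

firstDirections-unique : ∀ n m → Unique (firstDirections n m)
firstDirections-unique zero    m       = []
firstDirections-unique (suc n) zero    = []
firstDirections-unique (suc n) (suc m) =
  ¬Any⇒All¬ _ fzero∉ ∷ Unique.map⁺ Fin.suc-injective (firstDirections-unique n m)
  where
  fzero∉ : fzero ∉ map fsuc (firstDirections n m)
  fzero∉ fzero∈ with ∈-map⁻ fsuc fzero∈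
  ... | _ , _ , ()

firstDirections-enumerates : ∀ n m → Enumerates (firstDirections n m) (below m)
firstDirections-enumerates n m j = mk⇔ (below⇒∈ n m j) (∈⇒below n m j)
  where
  below⇒∈ : ∀ n m (j : Fin n) → below m j ≡ true → j ∈ firstDirections n m
  below⇒∈ (suc n) (suc m) fzero    _ = here refl
  below⇒∈ (suc n) (suc m) (fsuc j) h = there (∈-map⁺ fsuc (below⇒∈ n m j h))
  ∈⇒below : ∀ n m (j : Fin n) → j ∈ firstDirections n m → below m j ≡ true
  ∈⇒below (suc n) (suc m) .fzero (here refl) = refl
  ∈⇒below (suc n) (suc m) j      (there j∈) with ∈-map⁻ fsuc j∈
  ... | j′ , j′∈ , refl = ∈⇒below n m j′ j′∈

below-false⇒≤ : ∀ {n} m (i : Fin n) → below m i ≡ false → m ≤ n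
below-false⇒≤ zero    i        _ = z≤n
below-false⇒≤ (suc m) fzero    ()
below-false⇒≤ (suc m) (fsuc i) h = s≤s (below-false⇒≤ m i h)

count-below : ∀ n m → count n (below m) ≡ m ⊓ n
count-below zero    zero    = refl
count-below zero    (suc m) = refl
count-below (suc n) zero    = count-below n zero
count-below (suc n) (suc m) = cong suc (count-below n m)

below-saturated : ∀ n k m → 2 ^ m ≤ k → k < 2 ^ suc m → Saturated n k (directionSubgraph (below m))
below-saturated n k m small large = no-P_k , adding-creates-P_k
  where
  ds = firstDirections n m
  no-P_k : ¬ ContainsPath (directionSubgraph (below m)) k
  no-P_k = no-long-path (firstDirections-unique n m) (firstDirections-enumerates n m)
    (≤-trans (^-monoʳ-≤ 2 (subst (_≤ m) (sym (firstDirections-length n m)) (m⊓n≤m m n))) small)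
  adding-creates-P_k : ∀ v i → lookup v i ≡ false → below m i ≡ false →
    ContainsPath (addEdge (directionSubgraph (below m)) v i) k
  adding-creates-P_k v i vi≡false missing =
    adding-edge-creates-path (firstDirections-unique n m) (firstDirections-enumerates n m)
      (subst (λ l → k < 2 ^ suc l) (sym length≡m) large) v i vi≡false missing
    where
    length≡m : length ds ≡ m
    length≡m = trans (firstDirections-length n m) (m≤n⇒m⊓n≡m (below-false⇒≤ m i missing))

edgeCount-below : ∀ m n → edgeCount {suc n} (directionSubgraph (below m)) ≤ m * 2 ^ n
edgeCount-below m n = *-cancelˡ-≤ 2 (begin
  2 * edgeCount {suc n} (directionSubgraph (below m))
    ≡⟨ cong (2 *_) (edgeCount-directionSubgraph (suc n) (below m)) ⟩
  2 * ΣV (suc n) (upDegree (suc n) (below m))  ≡⟨ double-edgeCount (suc n) (below m) ⟩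
  count (suc n) (below m) * (2 * 2 ^ n)        ≡⟨ cong (_* (2 * 2 ^ n)) (count-below (suc n) m) ⟩
  (m ⊓ suc n) * (2 * 2 ^ n)                    ≤⟨ *-monoˡ-≤ (2 * 2 ^ n) (m⊓n≤m m (suc n)) ⟩
  m * (2 * 2 ^ n)                              ≡⟨ reorder m (2 ^ n) ⟩
  2 * (m * 2 ^ n)                              ∎)
  where
  open ≤-Reasoning
  reorder : ∀ m P → m * (2 * P) ≡ 2 * (m * P)
  reorder = solve-∀

-- With m = ⌊log₂ k⌋ we have 2^m ≤ k < 2^(m+1), so H_m witnesses the bound.
proposition1 : (k n : ℕ) → 1 ≤ k → 1 ≤ n →
    ∃[ H ] (Saturated n k H × edgeCount {n} H ≤ ⌊log₂ k ⌋ * 2 ^ (n ∸ 1))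
proposition1 k (suc n) 1≤k _ =
  directionSubgraph (below m) ,
  below-saturated (suc n) k m (2^⌊log₂⌋≤ k 1≤k) (<2^suc⌊log₂⌋ k) ,
  edgeCount-below m n
  where
  m = ⌊log₂ k ⌋
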